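{- Let $k\ge1$ and $n\ge1$ be integers. Then $$F^k_n=F_n^{k-1}+\sum_{j=0}^{n-k}F_j^{k-1}F_{n-k-j}^k.$$
   Context: For $k\ge0$ the numbers $F_n^k$ are defined by $F_n^k=0$ for $n<0$, $F_0^k=1$, and $F_n^k=F_{n-1}^k+\cdots+F_{n-k}^k$ for $n>0$ (so $F_n^0=0$ for $n\neq0$). Equivalently $F_n^k$ is the number of tilings of an $n\times1$ board by tiles of lengths in $\{1,\dots,k\}$. -}

module Defs where

open import Data.Nat using (ℕ; zero; suc; _+_; _*_; _∸_)
open import Data.List using (List; []; _∷_; take; map; upTo)
open import Data.Nat.ListAction using (sum)

-- hist k n = [F k n , F k (n-1) , … , F k 0]  (most recent first)
hist : ℕ → ℕ → List ℕ
hist k zero    = 1 ∷ []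
hist k (suc m) = sum (take k (hist k m)) ∷ hist k m

-- F k n = F_n^k : F_0^k = 1, F_n^k = F_{n-1}^k + ⋯ + F_{n-k}^k for n > 0,
-- where terms with negative index are 0 (they are simply absent from hist).
F : ℕ → ℕ → ℕ
F k n with hist k n
... | x ∷ _ = x
... | []    = 0

sumBelow : ℕ → (ℕ → ℕ) → ℕ
sumBelow m f = sum (map f (upTo m))

module Submission where

-- Regard sequences ℕ → ℕ as formal power series: 'shift' is
-- multiplication by x, 'window j f' = (x + ⋯ + x^j)·f, and 'conv' is the
-- Cauchy product.  The defining recurrence says  F_k = δ + window k F_k,
-- i.e. F_k·(1 - x - ⋯ - x^k) = 1.  With a = F_{k-1}, b = F_k and c = a·b,
-- expanding c once through the recurrence for a and once through the
-- recurrence for b (written as b = δ + x^k·b + window (k-1) b) gives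
--     c = b + window (k-1) c     and     c = a + x^k·c + window (k-1) c,
-- and cancelling the common term yields  b = a + x^k·c,  which read at
-- index n is the theorem.

open import Defs
open import Data.Nat using (ℕ; zero; suc; _+_; _*_; _∸_; _≤_)
open import Data.Nat.Properties
open import Data.List using (take; map; upTo; applyUpTo)
open import Data.List.Properties using (map-upTo; take-[])
open import Data.Nat.ListAction using (sum)
open import Function using (_∘_)
open import Relation.Binary.PropositionalEquality
open import Algebra.Properties.CommutativeSemigroup +-commutativeSemigroup
  using (interchange; x∙yz≈y∙xz)

Seq : Set
Seq = ℕ → ℕ

_≈_ : Seq → Seq → Set
f ≈ g = ∀ n → f n ≡ g n

infix 4 _≈_
infixl 6 _⊕_

≈-refl : ∀ {f} → f ≈ f
≈-refl n = refl

≈-trans : ∀ {f g h} → f ≈ g → g ≈ h → f ≈ h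
≈-trans e e′ n = trans (e n) (e′ n)

_⊕_ : Seq → Seq → Seq
(f ⊕ g) n = f n + g n

⊕-cong : ∀ {f f′ g g′} → f ≈ f′ → g ≈ g′ → f ⊕ g ≈ f′ ⊕ g′
⊕-cong e e′ n = cong₂ _+_ (e n) (e′ n)

𝟘 : Seq
𝟘 _ = 0

δ : Seq
δ zero    = 1
δ (suc _) = 0

shift : Seq → Seq
shift f zero    = 0
shift f (suc n) = f n

shift-cong : ∀ {f g} → f ≈ g → shift f ≈ shift g
shift-cong e zero    = refl
shift-cong e (suc n) = e n

shift-⊕ : ∀ f g → shift (f ⊕ g) ≈ shift f ⊕ shift g
shift-⊕ f g zero    = refl
shift-⊕ f g (suc n) = refl

shiftBy : ℕ → Seq → Seq
shiftBy zero    f = f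
shiftBy (suc i) f = shift (shiftBy i f)

window : ℕ → Seq → Seq
window zero    f = 𝟘
window (suc j) f = shift (f ⊕ window j f)

window-at-0 : ∀ j f → window j f 0 ≡ 0
window-at-0 zero    f = refl
window-at-0 (suc j) f = refl

window-suc : ∀ j f → window (suc j) f ≈ shiftBy (suc j) f ⊕ window j f
window-suc zero    f zero    = refl
window-suc zero    f (suc n) = refl
window-suc (suc j) f =
  ≈-trans (shift-cong (⊕-cong ≈-refl (window-suc j f)))
  (≈-trans (shift-cong reassociate)
           (shift-⊕ (shiftBy (suc j) f) (f ⊕ window j f)))
  where
  reassociate : f ⊕ (shiftBy (suc j) f ⊕ window j f)
              ≈ shiftBy (suc j) f ⊕ (f ⊕ window j f)
  reassociate n = x∙yz≈y∙xz (f n) (shiftBy (suc j) f n) (window j f n)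

record ShiftLinear (T : Seq → Seq) : Set where
  field
    T-cong  : ∀ {f g} → f ≈ g → T f ≈ T g
    T-𝟘     : T 𝟘 ≈ 𝟘
    T-⊕     : ∀ f g → T (f ⊕ g) ≈ T f ⊕ T g
    T-shift : ∀ f → T (shift f) ≈ shift (T f)

  T-shiftBy : ∀ i f → T (shiftBy i f) ≈ shiftBy i (T f)
  T-shiftBy zero    f = ≈-refl
  T-shiftBy (suc i) f =
    ≈-trans (T-shift (shiftBy i f)) (shift-cong (T-shiftBy i f))

  T-window : ∀ j f → T (window j f) ≈ window j (T f)
  T-window zero    f = T-𝟘
  T-window (suc j) f =
    ≈-trans (T-shift (f ⊕ window j f))
    (shift-cong (≈-trans (T-⊕ f (window j f)) (⊕-cong ≈-refl (T-window j f))))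

open ShiftLinear

conv : Seq → Seq → Seq
conv f g zero    = f 0 * g 0
conv f g (suc n) = f 0 * g (suc n) + conv (f ∘ suc) g n

conv-left : ∀ f → ShiftLinear (conv f)
conv-left f = record
  { T-cong  = congʳ f
  ; T-𝟘     = zeroʳ f
  ; T-⊕     = distribʳ f
  ; T-shift = shiftʳ f
  }
  where
  congʳ : ∀ f {g g′} → g ≈ g′ → conv f g ≈ conv f g′
  congʳ f e zero    = cong (f 0 *_) (e 0)
  congʳ f e (suc n) = cong₂ _+_ (cong (f 0 *_) (e (suc n))) (congʳ (f ∘ suc) e n)

  zeroʳ : ∀ f → conv f 𝟘 ≈ 𝟘
  zeroʳ f zero    = *-zeroʳ (f 0)
  zeroʳ f (suc n) = cong₂ _+_ (*-zeroʳ (f 0)) (zeroʳ (f ∘ suc) n)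

  distribʳ : ∀ f g h → conv f (g ⊕ h) ≈ conv f g ⊕ conv f h
  distribʳ f g h zero    = *-distribˡ-+ (f 0) (g 0) (h 0)
  distribʳ f g h (suc n) =
    trans (cong₂ _+_ (*-distribˡ-+ (f 0) (g (suc n)) (h (suc n)))
                     (distribʳ (f ∘ suc) g h n))
          (interchange (f 0 * g (suc n)) (f 0 * h (suc n))
                       (conv (f ∘ suc) g n) (conv (f ∘ suc) h n))

  -- At index n + 1 the extra last summand f (n + 1) * shift g 0 vanishes.
  shiftʳ : ∀ f g → conv f (shift g) ≈ shift (conv f g)
  shiftʳ f g zero          = *-zeroʳ (f 0)
  shiftʳ f g (suc zero)    =
    trans (cong (f 0 * g 0 +_) (*-zeroʳ (f 1))) (+-identityʳ (f 0 * g 0))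
  shiftʳ f g (suc (suc n)) = cong (f 0 * g (suc n) +_) (shiftʳ (f ∘ suc) g (suc n))

conv-right : ∀ g → ShiftLinear (λ f → conv f g)
conv-right g = record
  { T-cong  = congˡ
  ; T-𝟘     = zeroˡ
  ; T-⊕     = distribˡ
  ; T-shift = shiftˡ
  }
  where
  congˡ : ∀ {f f′} → f ≈ f′ → conv f g ≈ conv f′ g
  congˡ e zero    = cong (_* g 0) (e 0)
  congˡ e (suc n) = cong₂ _+_ (cong (_* g (suc n)) (e 0)) (congˡ (e ∘ suc) n)

  zeroˡ : conv 𝟘 g ≈ 𝟘
  zeroˡ zero    = refl
  zeroˡ (suc n) = zeroˡ n

  distribˡ : ∀ f h → conv (f ⊕ h) g ≈ conv f g ⊕ conv h g
  distribˡ f h zero    = *-distribʳ-+ (g 0) (f 0) (h 0)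
  distribˡ f h (suc n) =
    trans (cong₂ _+_ (*-distribʳ-+ (g (suc n)) (f 0) (h 0))
                     (distribˡ (f ∘ suc) (h ∘ suc) n))
          (interchange (f 0 * g (suc n)) (h 0 * g (suc n))
                       (conv (f ∘ suc) g n) (conv (h ∘ suc) g n))

  shiftˡ : ∀ f → conv (shift f) g ≈ shift (conv f g)
  shiftˡ f zero    = refl
  shiftˡ f (suc n) = refl

conv-δˡ : ∀ g → conv δ g ≈ g
conv-δˡ g zero    = +-identityʳ (g 0)
conv-δˡ g (suc n) =
  trans (cong₂ _+_ (+-identityʳ (g (suc n))) (T-𝟘 (conv-right g) n))
        (+-identityʳ (g (suc n)))

conv-δʳ : ∀ f → conv f δ ≈ f
conv-δʳ f zero    = *-identityʳ (f 0)
conv-δʳ f (suc n) = cong₂ _+_ (*-zeroʳ (f 0)) (conv-δʳ (f ∘ suc) n)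

sum-take-hist : ∀ k j m → sum (take j (hist k m)) ≡ window j (F k) (suc m)
sum-take-hist k zero    m       = refl
sum-take-hist k (suc j) zero    =
  cong suc (trans (cong sum (take-[] j)) (sym (window-at-0 j (F k))))
sum-take-hist k (suc j) (suc m) = cong (F k (suc m) +_) (sum-take-hist k j m)

F-recurrence : ∀ k → F k ≈ δ ⊕ window k (F k)
F-recurrence k zero    = cong suc (sym (window-at-0 k (F k)))
F-recurrence k (suc m) = sum-take-hist k k m

F-suc-decomposition :
  ∀ k → F (suc k) ≈ F k ⊕ shiftBy (suc k) (conv (F k) (F (suc k)))
F-suc-decomposition k n = +-cancelʳ-≡ (W n) _ _ (trans (sym via-a) via-b)
  where
  open ≡-Reasoning
  a = F k
  b = F (suc k)
  c = conv a b
  W = window k c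
  X = shiftBy (suc k) c

  via-a : c n ≡ b n + W n
  via-a = begin
    c n                                ≡⟨ T-cong (conv-right b) (F-recurrence k) n ⟩
    conv (δ ⊕ window k a) b n          ≡⟨ T-⊕ (conv-right b) δ (window k a) n ⟩
    conv δ b n + conv (window k a) b n ≡⟨ cong₂ _+_ (conv-δˡ b n) (T-window (conv-right b) k a n) ⟩
    b n + W n                          ∎

  via-b : c n ≡ (a n + X n) + W n
  via-b = begin
    c n
      ≡⟨ T-cong (conv-left a)
           (≈-trans (F-recurrence (suc k)) (⊕-cong ≈-refl (window-suc k b))) n ⟩
    conv a (δ ⊕ (shiftBy (suc k) b ⊕ window k b)) n
      ≡⟨ T-⊕ (conv-left a) δ _ n ⟩
    conv a δ n + conv a (shiftBy (suc k) b ⊕ window k b) n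
      ≡⟨ cong₂ _+_ (conv-δʳ a n) (T-⊕ (conv-left a) _ _ n) ⟩
    a n + (conv a (shiftBy (suc k) b) n + conv a (window k b) n)
      ≡⟨ cong (a n +_) (cong₂ _+_ (T-shiftBy (conv-left a) (suc k) b n)
                                  (T-window (conv-left a) k b n)) ⟩
    a n + (X n + W n)
      ≡⟨ sym (+-assoc (a n) (X n) (W n)) ⟩
    (a n + X n) + W n ∎

sumBelow-suc : ∀ m h → sumBelow (suc m) h ≡ h 0 + sumBelow m (h ∘ suc)
sumBelow-suc m h = begin
  sum (map h (upTo (suc m)))           ≡⟨ cong sum (map-upTo h (suc m)) ⟩
  h 0 + sum (applyUpTo (h ∘ suc) m)    ≡⟨ cong (h 0 +_) (cong sum (sym (map-upTo (h ∘ suc) m))) ⟩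
  h 0 + sumBelow m (h ∘ suc)           ∎
  where open ≡-Reasoning

conv-as-sum : ∀ f g n → conv f g n ≡ sumBelow (suc n) (λ j → f j * g (n ∸ j))
conv-as-sum f g zero    = sym (+-identityʳ (f 0 * g 0))
conv-as-sum f g (suc n) =
  trans (cong (f 0 * g (suc n) +_) (conv-as-sum (f ∘ suc) g n))
        (sym (sumBelow-suc (suc n) (λ j → f j * g (suc n ∸ j))))

shiftBy-conv-as-sum : ∀ i f g n →
  shiftBy i (conv f g) n ≡ sumBelow ((n + 1) ∸ i) (λ j → f j * g (n ∸ i ∸ j))
shiftBy-conv-as-sum zero    f g n       =
  trans (conv-as-sum f g n)
        (cong (λ t → sumBelow t (λ j → f j * g (n ∸ j))) (+-comm 1 n))
shiftBy-conv-as-sum (suc i) f g zero    =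
  cong (λ t → sumBelow t (λ j → f j * g (0 ∸ suc i ∸ j))) (sym (0∸n≡0 i))
shiftBy-conv-as-sum (suc i) f g (suc n) = shiftBy-conv-as-sum i f g n

theorem2p3 : (k n : ℕ) → 1 ≤ k → 1 ≤ n →
    F k n ≡ F (k ∸ 1) n + sumBelow ((n + 1) ∸ k) (λ j → F (k ∸ 1) j * F k (n ∸ k ∸ j))
theorem2p3 (suc k) n _ _ = begin
  F (suc k) n
    ≡⟨ F-suc-decomposition k n ⟩
  F k n + shiftBy (suc k) (conv (F k) (F (suc k))) n
    ≡⟨ cong (F k n +_) (shiftBy-conv-as-sum (suc k) (F k) (F (suc k)) n) ⟩
  F k n + sumBelow ((n + 1) ∸ suc k) (λ j → F k j * F (suc k) (n ∸ suc k ∸ j)) ∎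
  where open ≡-Reasoning
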